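{- Let $x=x_1\cdots x_n$ be a permutation of $\{1,\ldots,n\}$ and let $i$ be an index with $x_i>x_{i+1}$. Then $\lambda(x,i)$ is the unique minimal element, in the weak order, of the set $\{y\le x : (x_i,x_{i+1})\in\operatorname{inv}(y)\}$.
   Context: An inversion of a permutation $y=y_1\cdots y_n$ is a pair $(y_i,y_j)$ with $i<j$ and $y_i>y_j$; $\operatorname{inv}(y)$ denotes the set of inversions. The weak order on permutations of $\{1,\ldots,n\}$ is defined by $x\le y$ if and only if $\operatorname{inv}(x)\subseteq\operatorname{inv}(y)$. For a permutation $x$ with a descent $x_i>x_{i+1}$, $\lambda(x,i)$ is the permutation consisting of $1,\ldots,x_{i+1}-1$, then the values $\{x_j: j<i,\ x_{i+1}<x_j<x_i\}$ in increasing order, then $x_i$, then $x_{i+1}$, then the values $\{x_j: j>i+1,\ x_{i+1}<x_j<x_i\}$ in increasing order, and finally $x_i+1,\ldots,n$. -}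

module Defs where

open import Data.Nat using (ℕ; suc; _+_; _∸_; _<_; _≟_)
open import Data.List using (List; []; _∷_; _++_; map; upTo; filter)
open import Data.List.Membership.Propositional using (_∈_)
open import Data.List.Membership.DecPropositional _≟_ using (_∈?_)
open import Data.List.Relation.Binary.Permutation.Propositional using (_↭_)
open import Data.Product using (_×_; ∃; ∃-syntax)
open import Relation.Binary.PropositionalEquality using (_≡_)

IsPerm : ℕ → List ℕ → Set
IsPerm n w = w ↭ map suc (upTo n)

Inv : List ℕ → ℕ → ℕ → Set
Inv w a b = b < a × ∃[ u ] ∃[ v ] (w ≡ u ++ a ∷ v × b ∈ v)

_≤w_ : List ℕ → List ℕ → Set
x ≤w y = ∀ a b → Inv x a b → Inv y a b

between : ℕ → ℕ → List ℕ
between b a = map (λ k → b + suc k) (upTo (a ∸ b ∸ 1))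

-- λ(x,i) for x = u ++ xᵢ ∷ xᵢ₊₁ ∷ v, written with a = xᵢ, b = xᵢ₊₁:
-- 1,…,b-1, then {x_j : j<i, b<x_j<a} increasing, then a, b,
-- then {x_j : j>i+1, b<x_j<a} increasing, then a+1,…,n.
lam : ℕ → List ℕ → ℕ → ℕ → List ℕ → List ℕ
lam n u a b v =
  map suc (upTo (b ∸ 1))
  ++ filter (_∈? u) (between b a)
  ++ a ∷ b ∷ filter (_∈? v) (between b a)
  ++ map (λ k → a + suc k) (upTo (n ∸ a))

module Submission where

-- λ(x,i) is the concatenation of two increasing runs, 1‥b-1 · (u ∩ (b,a)) · a
-- and b · (v ∩ (b,a)) · a+1‥n (where x = u a b v), so in each of its inversions
-- (c,d) either c = a or c is a value of u in (b,a), and either d = b or d is a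
-- value of v in (b,a). A permutation y ≤ x inverting (a,b) must keep c before a
-- and b before d, these being non-inversions of x, hence it also inverts (c,d).
-- So λ(x,i) lies below every element of the set, which makes it minimal and the
-- only minimal element, by antisymmetry of the weak order.

open import Defs
open import Data.Nat using (ℕ; zero; suc; _+_; _∸_; _≤_; _<_; s≤s; z<s; _≟_)
open import Data.Nat.Properties
open import Data.List using (List; []; _∷_; _++_; [_]; map; upTo; filter)
open import Data.List.Properties using (++-assoc)
open import Data.List.Membership.Propositional using (_∈_)
open import Data.List.Membership.Propositional.Properties
open import Data.List.Membership.Propositional.Properties.WithK using (unique∧set⇒bag)
open import Data.List.Membership.DecPropositional _≟_ using (_∈?_)
open import Data.List.Relation.Unary.Any using (here; there)
open import Data.List.Relation.Unary.All as All using ([]; _∷_)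
open import Data.List.Relation.Unary.AllPairs as AllPairs using (AllPairs; []; _∷_)
import Data.List.Relation.Unary.AllPairs.Properties as AllPairs
open import Data.List.Relation.Unary.Unique.Propositional using (Unique)
open import Data.List.Relation.Unary.Unique.Propositional.Properties using (Unique[x∷xs]⇒x∉xs; ++⁺)
open import Data.List.Relation.Binary.Permutation.Propositional using (_↭_; ↭-sym; ↭-trans; ↭⇒↭ₛ)
open import Data.List.Relation.Binary.Permutation.Propositional.Properties using (∈-resp-↭; drop-∷)
open import Relation.Binary.PropositionalEquality using (_≡_; _≢_; refl; sym; trans; cong; subst; setoid; module ≡-Reasoning)
open import Data.List.Relation.Binary.Permutation.Setoid.Properties (setoid ℕ) using (Unique-resp-↭)
open import Data.List.Relation.Binary.BagAndSetEquality using (∼bag⇒↭)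
open import Data.Product using (_×_; _,_; ∃-syntax; proj₁; proj₂)
open import Data.Sum using (_⊎_; inj₁; inj₂)
open import Function.Base using (_∘_)
open import Function.Bundles using (mk⇔)
open import Relation.Binary.Definitions using (tri<; tri≈; tri>)
open import Relation.Nullary using (¬_; contradiction)

private variable
  A : Set
  c d e : A
  xs ys w : List A

data Precedes {A : Set} : List A → A → A → Set where
  now   : ∀ {c d xs} → d ∈ xs → Precedes (c ∷ xs) c d
  later : ∀ {x c d xs} → Precedes xs c d → Precedes (x ∷ xs) c d

split⇒Precedes : ∀ u {v} → w ≡ u ++ c ∷ v → d ∈ v → Precedes w c d
split⇒Precedes []      refl d∈v = now d∈v
split⇒Precedes (x ∷ u) refl d∈v = later (split⇒Precedes u refl d∈v)

Precedes⇒split : Precedes w c d → ∃[ u ] ∃[ v ] (w ≡ u ++ c ∷ v × d ∈ v)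
Precedes⇒split (now {xs = xs} d∈xs) = [] , xs , refl , d∈xs
Precedes⇒split (later {x = x} p) with Precedes⇒split p
... | u , v , refl , d∈v = x ∷ u , v , refl , d∈v

Precedes-∈ˡ : Precedes w c d → c ∈ w
Precedes-∈ˡ (now _)   = here refl
Precedes-∈ˡ (later p) = there (Precedes-∈ˡ p)

Precedes-∈ʳ : Precedes w c d → d ∈ w
Precedes-∈ʳ (now d∈xs) = there d∈xs
Precedes-∈ʳ (later p)  = there (Precedes-∈ʳ p)

Precedes-++⁻ : ∀ xs → Precedes (xs ++ ys) c d →
  Precedes xs c d ⊎ (c ∈ xs × d ∈ ys) ⊎ Precedes ys c d
Precedes-++⁻ []       p = inj₂ (inj₂ p)
Precedes-++⁻ (x ∷ xs) (now d∈) with ∈-++⁻ xs d∈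
... | inj₁ d∈xs = inj₁ (now d∈xs)
... | inj₂ d∈ys = inj₂ (inj₁ (here refl , d∈ys))
Precedes-++⁻ (x ∷ xs) (later p) with Precedes-++⁻ xs p
... | inj₁ q              = inj₁ (later q)
... | inj₂ (inj₁ (c∈ , d∈)) = inj₂ (inj₁ (there c∈ , d∈))
... | inj₂ (inj₂ q)       = inj₂ (inj₂ q)

Precedes-++⁺ʳ : ∀ xs → Precedes ys c d → Precedes (xs ++ ys) c d
Precedes-++⁺ʳ []       p = p
Precedes-++⁺ʳ (x ∷ xs) p = later (Precedes-++⁺ʳ xs p)

Precedes-across : c ∈ xs → d ∈ ys → Precedes (xs ++ ys) c d
Precedes-across {xs = _ ∷ xs} (here refl) d∈ys = now (∈-++⁺ʳ xs d∈ys)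
Precedes-across (there c∈xs) d∈ys = later (Precedes-across c∈xs d∈ys)

Precedes-AllPairs : ∀ {R : A → A → Set} → AllPairs R w → Precedes w c d → R c d
Precedes-AllPairs (Rc ∷ _) (now d∈)  = All.lookup Rc d∈
Precedes-AllPairs (_ ∷ R!) (later p) = Precedes-AllPairs R! p

Precedes-irrefl : Unique w → ¬ Precedes w c c
Precedes-irrefl w! (now c∈) = Unique[x∷xs]⇒x∉xs w! c∈
Precedes-irrefl (_ ∷ w!) (later p) = Precedes-irrefl w! p

Precedes-trans : Unique w → Precedes w c d → Precedes w d e → Precedes w c e
Precedes-trans w!       (now _)   (now e∈)  = now e∈
Precedes-trans w!       (now _)   (later q) = now (Precedes-∈ʳ q)
Precedes-trans w!       (later p) (now _)   = contradiction (Precedes-∈ʳ p) (Unique[x∷xs]⇒x∉xs w!)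
Precedes-trans (_ ∷ w!) (later p) (later q) = later (Precedes-trans w! p q)

Precedes-asym : Unique w → Precedes w c d → ¬ Precedes w d c
Precedes-asym w! p q = Precedes-irrefl w! (Precedes-trans w! p q)

Precedes-total : c ∈ w → d ∈ w → c ≢ d → Precedes w c d ⊎ Precedes w d c
Precedes-total (here refl) (here refl) c≢d = contradiction refl c≢d
Precedes-total (here refl) (there d∈)  _   = inj₁ (now d∈)
Precedes-total (there c∈)  (here refl) _   = inj₂ (now c∈)
Precedes-total (there c∈)  (there d∈)  c≢d with Precedes-total c∈ d∈ c≢d
... | inj₁ p = inj₁ (later p)
... | inj₂ p = inj₂ (later p)

Precedes-⊆⇒≡ : Unique xs → Unique ys → xs ↭ ys →
  (∀ {c d} → Precedes xs c d → Precedes ys c d) → xs ≡ ys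
Precedes-⊆⇒≡ {xs = []}    {ys = []}    _ _ _ _ = refl
Precedes-⊆⇒≡ {xs = []}    {ys = _ ∷ _} _ _ xs↭ys _ with () ← ∈-resp-↭ (↭-sym xs↭ys) (here refl)
Precedes-⊆⇒≡ {xs = _ ∷ _} {ys = []}    _ _ xs↭ys _ with () ← ∈-resp-↭ xs↭ys (here refl)
Precedes-⊆⇒≡ {xs = x ∷ xs} {ys = y ∷ ys} xs! ys! xs↭ys ⊆ with ∈-resp-↭ (↭-sym xs↭ys) (here refl)
... | here refl = cong (x ∷_) (Precedes-⊆⇒≡ (AllPairs.tail xs!) (AllPairs.tail ys!) (drop-∷ xs↭ys) ⊆′)
  where
  ⊆′ : Precedes xs c d → Precedes ys c d
  ⊆′ p with ⊆ (later p)
  ... | now _   = contradiction (Precedes-∈ˡ p) (Unique[x∷xs]⇒x∉xs xs!)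
  ... | later q = q
... | there y∈xs with ⊆ (now y∈xs)
...   | now _   = contradiction y∈xs (Unique[x∷xs]⇒x∉xs xs!)
...   | later p = contradiction (Precedes-∈ʳ p) (Unique[x∷xs]⇒x∉xs ys!)

+suc<⇒<∸∸1 : ∀ m l {k} → m + suc k < l → k < l ∸ m ∸ 1
+suc<⇒<∸∸1 zero    (suc l) (s≤s k<l) = k<l
+suc<⇒<∸∸1 (suc m) (suc l) (s≤s p)   = +suc<⇒<∸∸1 m l p

<∸∸1⇒+suc< : ∀ m l {k} → k < l ∸ m ∸ 1 → m + suc k < l
<∸∸1⇒+suc< zero    (suc l) k<l = s≤s k<l
<∸∸1⇒+suc< (suc m) (suc l) k<  = s≤s (<∸∸1⇒+suc< m l k<)

∈-between⁻ : ∀ m l {z} → z ∈ between m l → m < z × z < l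
∈-between⁻ m l z∈ with ∈-map⁻ (λ k → m + suc k) z∈
... | k , k∈ , refl = m<m+n m z<s , <∸∸1⇒+suc< m l (∈-upTo⁻ k∈)

∈-between⁺ : ∀ {m l z} → m < z → z < l → z ∈ between m l
∈-between⁺ {m} {l} {z} m<z z<l =
  subst (_∈ between m l) m+suc[z∸suc[m]]≡z
    (∈-map⁺ (λ k → m + suc k) (∈-upTo⁺ (+suc<⇒<∸∸1 m l (subst (_< l) (sym m+suc[z∸suc[m]]≡z) z<l))))
  where
  m+suc[z∸suc[m]]≡z : m + suc (z ∸ suc m) ≡ z
  m+suc[z∸suc[m]]≡z = trans (+-suc m (z ∸ suc m)) (m+[n∸m]≡n m<z)

between-increasing : ∀ m l → AllPairs _<_ (between m l)
between-increasing m l =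
  AllPairs.map⁺ (AllPairs.applyUpTo⁺₁ (λ k → k) (l ∸ m ∸ 1) (λ i<j _ → +-monoʳ-< m (s≤s i<j)))

∈-filter-between : ∀ w m l {z} → z ∈ filter (_∈? w) (between m l) → z ∈ w × m < z × z < l
∈-filter-between w m l z∈ with ∈-filter⁻ (_∈? w) {xs = between m l} z∈
... | z∈between , z∈w = z∈w , ∈-between⁻ m l z∈between

Inv⇒Precedes : ∀ {w a b} → Inv w a b → Precedes w a b
Inv⇒Precedes (_ , u , _ , w≡ , b∈v) = split⇒Precedes u w≡ b∈v

Precedes⇒Inv : ∀ {w a b} → b < a → Precedes w a b → Inv w a b
Precedes⇒Inv b<a p = b<a , Precedes⇒split p

increasing⇒Unique : ∀ {w} → AllPairs _<_ w → Unique w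
increasing⇒Unique = AllPairs.map <⇒≢

increasing-++ : ∀ {xs ys} → AllPairs _<_ xs → AllPairs _<_ ys →
  (∀ {c d} → c ∈ xs → d ∈ ys → c < d) → AllPairs _<_ (xs ++ ys)
increasing-++ xs< ys< xs<ys =
  AllPairs.++⁺ xs< ys< (All.tabulate λ c∈ → All.tabulate λ d∈ → xs<ys c∈ d∈)

inversion-++-increasingˡ : ∀ {xs ys c d} → AllPairs _<_ xs → d < c →
  Precedes (xs ++ ys) c d → (c ∈ xs × d ∈ ys) ⊎ Precedes ys c d
inversion-++-increasingˡ {xs} xs< d<c p with Precedes-++⁻ xs p
... | inj₁ q = contradiction (Precedes-AllPairs xs< q) (<-asym d<c)
... | inj₂ r = r

≤w⇒Precedes : ∀ {x y c d} → Unique x → y ≤w x → c < d →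
  Precedes x c d → c ∈ y → d ∈ y → Precedes y c d
≤w⇒Precedes x! y≤x c<d p c∈y d∈y with Precedes-total c∈y d∈y (<⇒≢ c<d)
... | inj₁ q = q
... | inj₂ q = contradiction (Inv⇒Precedes (y≤x _ _ (Precedes⇒Inv c<d q))) (Precedes-asym x! p)

≤w-antisym : ∀ {x y} → Unique x → Unique y → x ↭ y → x ≤w y → y ≤w x → x ≡ y
≤w-antisym {x} {y} x! y! x↭y x≤y y≤x = Precedes-⊆⇒≡ x! y! x↭y x⊆y
  where
  x⊆y : ∀ {c d} → Precedes x c d → Precedes y c d
  x⊆y {c} {d} p with <-cmp c d
  ... | tri< c<d _ _ = ≤w⇒Precedes x! y≤x c<d p (∈-resp-↭ x↭y (Precedes-∈ˡ p)) (∈-resp-↭ x↭y (Precedes-∈ʳ p))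
  ... | tri≈ _ refl _ = contradiction p (Precedes-irrefl x!)
  ... | tri> _ _ d<c = Inv⇒Precedes (x≤y c d (Precedes⇒Inv d<c p))

IsPerm⇒Unique : ∀ {n w} → IsPerm n w → Unique w
IsPerm⇒Unique {n} w↭ = Unique-resp-↭ (↭⇒↭ₛ (↭-sym w↭)) (increasing⇒Unique (between-increasing 0 (suc n)))

module Lambda (n : ℕ) (u : List ℕ) (a b : ℕ) (v : List ℕ)
              (x-perm : IsPerm n (u ++ a ∷ b ∷ v)) (b<a : b < a) where

  x : List ℕ
  x = u ++ a ∷ b ∷ v

  x-unique : Unique x
  x-unique = IsPerm⇒Unique x-perm

  x-bounds : ∀ {z} → z ∈ x → 0 < z × z < suc n
  x-bounds z∈x = ∈-between⁻ 0 (suc n) (∈-resp-↭ x-perm z∈x)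

  a∈x : a ∈ x
  a∈x = ∈-++⁺ʳ u (here refl)

  b∈x : b ∈ x
  b∈x = ∈-++⁺ʳ u (there (here refl))

  u-v-disjoint : ∀ {z} → z ∈ u → ¬ z ∈ v
  u-v-disjoint z∈u z∈v = Precedes-irrefl x-unique (Precedes-across z∈u (there (there z∈v)))

  P F₁ F₂ Q M N L R : List ℕ
  P  = between 0 b
  F₁ = filter (_∈? u) (between b a)
  F₂ = filter (_∈? v) (between b a)
  Q  = map (λ k → a + suc k) (upTo (n ∸ a))
  M  = F₁ ++ [ a ]
  N  = b ∷ F₂
  L  = P ++ M
  R  = N ++ Q

  lam≡L++R : lam n u a b v ≡ L ++ R
  lam≡L++R = begin
    P ++ F₁ ++ a ∷ R       ≡⟨ cong (P ++_) (sym (++-assoc F₁ [ a ] R)) ⟩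
    P ++ (F₁ ++ [ a ]) ++ R ≡⟨ sym (++-assoc P M R) ⟩
    L ++ R                 ∎
    where open ≡-Reasoning

  Q≡between : Q ≡ between a (suc n)
  Q≡between = cong (λ k → map (λ j → a + suc j) (upTo k)) (sym (pred[m∸n]≡m∸[1+n] (suc n) a))

  ∈Q⁻ : ∀ {z} → z ∈ Q → a < z × z < suc n
  ∈Q⁻ z∈Q = ∈-between⁻ a (suc n) (subst (_ ∈_) Q≡between z∈Q)

  ∈Q⁺ : ∀ {z} → a < z → z < suc n → z ∈ Q
  ∈Q⁺ a<z z<1+n = subst (_ ∈_) (sym Q≡between) (∈-between⁺ a<z z<1+n)

  Large Small : ℕ → Set
  Large c = c ≡ a ⊎ (c ∈ u × b < c × c < a)
  Small d = d ≡ b ⊎ (d ∈ v × b < d × d < a)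

  Large-bounds : ∀ {z} → Large z → b < z × z ≤ a
  Large-bounds (inj₁ refl)              = b<a , ≤-refl
  Large-bounds (inj₂ (_ , b<z , z<a)) = b<z , <⇒≤ z<a

  Small-bounds : ∀ {z} → Small z → b ≤ z × z < a
  Small-bounds (inj₁ refl)              = ≤-refl , b<a
  Small-bounds (inj₂ (_ , b<z , z<a)) = <⇒≤ b<z , z<a

  Large⇒∈x : ∀ {z} → Large z → z ∈ x
  Large⇒∈x (inj₁ refl)       = a∈x
  Large⇒∈x (inj₂ (z∈u , _)) = ∈-++⁺ˡ z∈u

  Small⇒∈x : ∀ {z} → Small z → z ∈ x
  Small⇒∈x (inj₁ refl)       = b∈x
  Small⇒∈x (inj₂ (z∈v , _)) = ∈-++⁺ʳ u (there (there z∈v))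

  Large-Small-disjoint : ∀ {z} → Large z → ¬ Small z
  Large-Small-disjoint (inj₁ z≡a) (inj₁ z≡b) = <-irrefl (trans (sym z≡b) z≡a) b<a
  Large-Small-disjoint (inj₁ refl) (inj₂ (_ , _ , a<a)) = <-irrefl refl a<a
  Large-Small-disjoint (inj₂ (_ , b<b , _)) (inj₁ refl) = <-irrefl refl b<b
  Large-Small-disjoint (inj₂ (z∈u , _)) (inj₂ (z∈v , _)) = u-v-disjoint z∈u z∈v

  M-Large : ∀ {z} → z ∈ M → Large z
  M-Large z∈M with ∈-++⁻ F₁ z∈M
  ... | inj₁ z∈F₁      = inj₂ (∈-filter-between u b a z∈F₁)
  ... | inj₂ (here refl) = inj₁ refl

  N-Small : ∀ {z} → z ∈ N → Small z
  N-Small (here refl)  = inj₁ refl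
  N-Small (there z∈F₂) = inj₂ (∈-filter-between v b a z∈F₂)

  L-increasing : AllPairs _<_ L
  L-increasing = increasing-++ (between-increasing 0 b) M-increasing
    λ c∈P d∈M → <-trans (proj₂ (∈-between⁻ 0 b c∈P)) (proj₁ (Large-bounds (M-Large d∈M)))
    where
    M-increasing : AllPairs _<_ M
    M-increasing = increasing-++ (AllPairs.filter⁺ (_∈? u) (between-increasing b a)) ([] ∷ [])
      λ { c∈F₁ (here refl) → proj₂ (proj₂ (∈-filter-between u b a c∈F₁)) }

  R-increasing : AllPairs _<_ R
  R-increasing = increasing-++ N-increasing Q-increasing
    λ c∈N d∈Q → <-trans (proj₂ (Small-bounds (N-Small c∈N))) (proj₁ (∈Q⁻ d∈Q))
    where
    N-increasing : AllPairs _<_ N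
    N-increasing = increasing-++ ([] ∷ []) (AllPairs.filter⁺ (_∈? v) (between-increasing b a))
      λ { (here refl) d∈F₂ → proj₁ (proj₂ (∈-filter-between v b a d∈F₂)) }
    Q-increasing : AllPairs _<_ Q
    Q-increasing = subst (AllPairs _<_) (sym Q≡between) (between-increasing a (suc n))

  L-R-cross : ∀ {c d} → c ∈ L → d ∈ R → d ≤ c → Large c × Small d
  L-R-cross {c} {d} c∈L d∈R d≤c with ∈-++⁻ P c∈L | ∈-++⁻ N d∈R
  ... | inj₂ c∈M | inj₁ d∈N = M-Large c∈M , N-Small d∈N
  ... | inj₁ c∈P | inj₁ d∈N = contradiction (begin-strict
        d ≤⟨ d≤c ⟩ c <⟨ proj₂ (∈-between⁻ 0 b c∈P) ⟩ b ≤⟨ proj₁ (Small-bounds (N-Small d∈N)) ⟩ d ∎) (<-irrefl refl)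
    where open ≤-Reasoning
  ... | inj₁ c∈P | inj₂ d∈Q = contradiction (begin-strict
        d ≤⟨ d≤c ⟩ c <⟨ proj₂ (∈-between⁻ 0 b c∈P) ⟩ b <⟨ b<a ⟩ a <⟨ proj₁ (∈Q⁻ d∈Q) ⟩ d ∎) (<-irrefl refl)
    where open ≤-Reasoning
  ... | inj₂ c∈M | inj₂ d∈Q = contradiction (begin-strict
        d ≤⟨ d≤c ⟩ c ≤⟨ proj₂ (Large-bounds (M-Large c∈M)) ⟩ a <⟨ proj₁ (∈Q⁻ d∈Q) ⟩ d ∎) (<-irrefl refl)
    where open ≤-Reasoning

  lam-inversion : ∀ {c d} → d < c → Precedes (lam n u a b v) c d → Large c × Small d
  lam-inversion d<c p
    with inversion-++-increasingˡ L-increasing d<c (subst (λ w → Precedes w _ _) lam≡L++R p)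
  ... | inj₁ (c∈L , d∈R) = L-R-cross c∈L d∈R (<⇒≤ d<c)
  ... | inj₂ q = contradiction (Precedes-AllPairs R-increasing q) (<-asym d<c)

  lam-below : ∀ {w} → Unique w → Precedes w a b →
    (∀ {c} → c ∈ u → c < a → Precedes w c a) →
    (∀ {d} → d ∈ v → b < d → Precedes w b d) →
    lam n u a b v ≤w w
  lam-below {w} w! ab ca bd c d inv@(d<c , _) with lam-inversion d<c (Inv⇒Precedes inv)
  ... | large , small = Precedes⇒Inv d<c (after-b small (before-a large))
    where
    before-a : Large c → Precedes w c b
    before-a (inj₁ refl)               = ab
    before-a (inj₂ (c∈u , _ , c<a)) = Precedes-trans w! (ca c∈u c<a) ab
    after-b : Small d → Precedes w c b → Precedes w c d
    after-b (inj₁ refl)               cb = cb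
    after-b (inj₂ (d∈v , b<d , _)) cb = Precedes-trans w! cb (bd d∈v b<d)

  lam≤x : lam n u a b v ≤w x
  lam≤x = lam-below x-unique (Precedes-++⁺ʳ u (now (here refl)))
    (λ c∈u _ → Precedes-across c∈u (here refl))
    (λ d∈v _ → Precedes-++⁺ʳ u (later (now d∈v)))

  lam-inverts : Inv (lam n u a b v) a b
  lam-inverts = Precedes⇒Inv b<a (Precedes-++⁺ʳ P (Precedes-++⁺ʳ F₁ (now (here refl))))

  lam-least : ∀ y → IsPerm n y → y ≤w x → Inv y a b → lam n u a b v ≤w y
  lam-least y y-perm y≤x y-inv = lam-below y-unique (Inv⇒Precedes y-inv)
    (λ c∈u c<a → keep c<a (Precedes-across c∈u (here refl)))
    (λ d∈v b<d → keep b<d (Precedes-++⁺ʳ u (later (now d∈v))))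
    where
    y-unique : Unique y
    y-unique = IsPerm⇒Unique y-perm
    x⊆y : ∀ {z} → z ∈ x → z ∈ y
    x⊆y = ∈-resp-↭ (↭-trans x-perm (↭-sym y-perm))
    keep : ∀ {c d} → c < d → Precedes x c d → Precedes y c d
    keep c<d p = ≤w⇒Precedes x-unique y≤x c<d p (x⊆y (Precedes-∈ˡ p)) (x⊆y (Precedes-∈ʳ p))

  lam-unique : Unique (lam n u a b v)
  lam-unique = subst Unique (sym lam≡L++R)
    (++⁺ (increasing⇒Unique L-increasing) (increasing⇒Unique R-increasing)
      λ (z∈L , z∈R) → let large , small = L-R-cross z∈L z∈R ≤-refl in Large-Small-disjoint large small)

  lam-bounds : ∀ {z} → z ∈ lam n u a b v → 0 < z × z < suc n
  lam-bounds z∈lam with ∈-++⁻ L (subst (_ ∈_) lam≡L++R z∈lam)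
  ... | inj₁ z∈L with ∈-++⁻ P z∈L
  ...   | inj₁ z∈P = let 0<z , z<b = ∈-between⁻ 0 b z∈P in
                     0<z , <-trans z<b (<-trans b<a (proj₂ (x-bounds a∈x)))
  ...   | inj₂ z∈M = x-bounds (Large⇒∈x (M-Large z∈M))
  lam-bounds z∈lam | inj₂ z∈R with ∈-++⁻ N z∈R
  ...   | inj₁ z∈N = x-bounds (Small⇒∈x (N-Small z∈N))
  ...   | inj₂ z∈Q = let a<z , z<1+n = ∈Q⁻ z∈Q in <-trans (proj₁ (x-bounds a∈x)) a<z , z<1+n

  from-a⊆lam : ∀ {z} → z ∈ a ∷ b ∷ F₂ ++ Q → z ∈ lam n u a b v
  from-a⊆lam = ∈-++⁺ʳ P ∘ ∈-++⁺ʳ F₁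

  x⊆lam : ∀ {z} → z ∈ x → z ∈ lam n u a b v
  x⊆lam {z} z∈x with x-bounds z∈x | <-cmp z b
  ... | 0<z , _ | tri< z<b _ _ = ∈-++⁺ˡ (∈-between⁺ 0<z z<b)
  ... | _ | tri≈ _ refl _ = from-a⊆lam (there (here refl))
  ... | _ , z<1+n | tri> _ _ b<z with <-cmp z a
  ...   | tri≈ _ refl _ = from-a⊆lam (here refl)
  ...   | tri> _ _ a<z = from-a⊆lam (there (there (∈-++⁺ʳ F₂ (∈Q⁺ a<z z<1+n))))
  ...   | tri< z<a _ _ with ∈-++⁻ u z∈x
  ...     | inj₁ z∈u = ∈-++⁺ʳ P (∈-++⁺ˡ (∈-filter⁺ (_∈? u) (∈-between⁺ b<z z<a) z∈u))
  ...     | inj₂ (here refl) = contradiction z<a (<-irrefl refl)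
  ...     | inj₂ (there (here refl)) = contradiction b<z (<-irrefl refl)
  ...     | inj₂ (there (there z∈v)) =
              from-a⊆lam (there (there (∈-++⁺ˡ (∈-filter⁺ (_∈? v) (∈-between⁺ b<z z<a) z∈v))))

  lam-perm : IsPerm n (lam n u a b v)
  lam-perm = ∼bag⇒↭ (unique∧set⇒bag lam-unique (increasing⇒Unique (between-increasing 0 (suc n))) (mk⇔
    (λ z∈lam → let 0<z , z<1+n = lam-bounds z∈lam in ∈-between⁺ 0<z z<1+n)
    (λ z∈range → x⊆lam (∈-resp-↭ (↭-sym x-perm) z∈range))))

proposition2p3 : (n : ℕ) (x u : List ℕ) (a b : ℕ) (v : List ℕ) →
    IsPerm n x → x ≡ u ++ a ∷ b ∷ v → b < a →
    (IsPerm n (lam n u a b v) × lam n u a b v ≤w x × Inv (lam n u a b v) a b)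
    × (∀ y → IsPerm n y → y ≤w x → Inv y a b → y ≤w lam n u a b v → y ≡ lam n u a b v)
    × (∀ z → IsPerm n z → z ≤w x → Inv z a b →
         (∀ y → IsPerm n y → y ≤w x → Inv y a b → y ≤w z → y ≡ z) →
         z ≡ lam n u a b v)
proposition2p3 n _ u a b v x-perm refl b<a =
    (lam-perm , lam≤x , lam-inverts)
  , (λ y y-perm y≤x y-inv y≤lam →
       ≤w-antisym (IsPerm⇒Unique y-perm) lam-unique (↭-trans y-perm (↭-sym lam-perm))
         y≤lam (lam-least y y-perm y≤x y-inv))
  , (λ z z-perm z≤x z-inv z-minimal →
       sym (z-minimal _ lam-perm lam≤x lam-inverts (lam-least z z-perm z≤x z-inv)))
  where open Lambda n u a b v x-perm b<a
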